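{- For every real number $M>0$ there exist connected graphs $G$ and $H$ with $H$ a subgraph of $G$ such that $\frac{\dim(H)}{\dim(G)}>M$, $\frac{\mathrm{bdim}(H)}{\mathrm{bdim}(G)}>M$ and $\frac{\mathrm{adim}(H)}{\mathrm{adim}(G)}>M$.
   Context: All graphs are finite, simple and undirected. For vertices $x,y$ of $G$, $d(x,y)$ is the length of a shortest $x$–$y$ path, and for a positive integer $i$, $d_i(x,y)=\min\{d(x,y),i+1\}$. A set $S\subseteq V(G)$ is a resolving set if for any two distinct $x,y$ there is $z\in S$ with $d(x,z)\neq d(y,z)$; $\dim(G)$ is the minimum cardinality of a resolving set. $S$ is an adjacency resolving set if for any two distinct $x,y$ there is $z\in S$ with $d_1(x,z)\neq d_1(y,z)$; $\mathrm{adim}(G)$ is the minimum cardinality of such a set. A function $f:V(G)\to\mathbb{Z}_{\ge0}$ is a resolving broadcast if for any two distinct $x,y$ there is $z$ with $f(z)=i>0$ and $d_i(x,z)\neq d_i(y,z)$; $\mathrm{bdim}(G)$ is the minimum of $\sum_v f(v)$ over all resolving broadcasts $f$ of $G$. -}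

module Defs where

open import Data.Nat using (ℕ; zero; suc; _<_; _⊔_; _⊓_; _+_; _*_)
open import Data.Fin using (Fin)
open import Data.Fin.Subset using (Subset; _∈_; ∣_∣)
open import Data.Bool using (Bool; true; false)
open import Data.Vec using (tabulate; sum)
open import Data.Product using (Σ; ∃; _×_; _,_)
open import Relation.Binary.PropositionalEquality using (_≡_; _≢_)
open import Function.Definitions using (Injective)

record Graph : Set where
  field
    n     : ℕ
    adj   : Fin n → Fin n → Bool
    sym   : ∀ x y → adj x y ≡ adj y x
    irr   : ∀ x → adj x x ≡ false
open Graph public

V : Graph → Set
V G = Fin (n G)

data Walk (G : Graph) : V G → V G → ℕ → Set where
  nil  : ∀ x → Walk G x x 0
  cons : ∀ {x y z k} → adj G x y ≡ true → Walk G y z k → Walk G x z (suc k)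

Connected : Graph → Set
Connected G = ∀ x y → ∃ λ k → Walk G x y k

Dist : (G : Graph) → V G → V G → ℕ → Set
Dist G x y k = Walk G x y k × (∀ m → m < k → Walk G x y m → Data.Empty.⊥)
  where import Data.Empty

trunc : ℕ → ℕ → ℕ
trunc i d = d ⊓ suc i

DistinguishesT : (G : Graph) → ℕ → V G → V G → V G → Set
DistinguishesT G i z x y = ∀ a b → Dist G x z a → Dist G y z b → trunc i a ≢ trunc i b

Distinguishes : (G : Graph) → V G → V G → V G → Set
Distinguishes G z x y = ∀ a b → Dist G x z a → Dist G y z b → a ≢ b

IsResolving : (G : Graph) → Subset (n G) → Set
IsResolving G S = ∀ x y → x ≢ y → Σ (V G) λ z → (z ∈ S) × Distinguishes G z x y

IsAdjResolving : (G : Graph) → Subset (n G) → Set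
IsAdjResolving G S = ∀ x y → x ≢ y → Σ (V G) λ z → (z ∈ S) × DistinguishesT G 1 z x y

IsResolvingBroadcast : (G : Graph) → (V G → ℕ) → Set
IsResolvingBroadcast G f = ∀ x y → x ≢ y →
  Σ (V G) λ z → Σ ℕ λ i → (f z ≡ suc i) × DistinguishesT G (suc i) z x y

cost : (G : Graph) → (V G → ℕ) → ℕ
cost G f = sum (tabulate f)

IsDim : Graph → ℕ → Set
IsDim G k = (Σ (Subset (n G)) λ S → IsResolving G S × ∣ S ∣ ≡ k)
          × (∀ S → IsResolving G S → k Data.Nat.≤ ∣ S ∣)

IsAdim : Graph → ℕ → Set
IsAdim G k = (Σ (Subset (n G)) λ S → IsAdjResolving G S × ∣ S ∣ ≡ k)
           × (∀ S → IsAdjResolving G S → k Data.Nat.≤ ∣ S ∣)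

IsBdim : Graph → ℕ → Set
IsBdim G k = (Σ (V G → ℕ) λ f → IsResolvingBroadcast G f × cost G f ≡ k)
           × (∀ f → IsResolvingBroadcast G f → k Data.Nat.≤ cost G f)

Subgraph : Graph → Graph → Set
Subgraph H G = Σ (V H → V G) λ ι → Injective _≡_ _≡_ ι ×
  (∀ u v → adj H u v ≡ true → adj G (ι u) (ι v) ≡ true)

module Submission where

-- If a graph has a universal vertex, every distance is 0, 1 or 2,
-- so the distance d(x,z) is determined by adjacency and all three notions
-- of resolution (metric, adjacency, broadcast) coincide: a set S that
-- separates vertices by their adjacency pattern is resolving in all three
-- senses, and a pair of twins must meet the support of every resolving
-- set or broadcast.  Hence dim = bdim = adim whenever a separating set is
-- exactly as large as the number of twin pairs forced by a counting
-- argument (lemma 'dimensions').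
--
-- For every k we build a graph G with a universal
-- vertex, t = 2k twin pairs and k² extra vertices separated by one vertex
-- of each twin pair, so dim G = bdim G = adim G = t.  The spanning star H
-- of G (the universal vertex joined to all other vertices) has pairwise
-- twin leaves, so its three parameters equal (number of vertices) - 2,
-- which is of order k².  Taking k = 2M + 2 makes every ratio exceed M.

open import Defs hiding (sym)
open import Data.Nat using (ℕ; zero; suc; _<_; _≤_; _+_; _*_; z≤n; s≤s; NonZero; >-nonZero)
open import Data.Nat.Properties
  using (≤-trans; <-≤-trans; n≤1+n; m≤n+m; m≤m+n; +-mono-≤; +-monoʳ-≤; +-assoc; m≤n⇒m⊓n≡m; <-cmp;
         *-distribˡ-+; *-distribʳ-+; *-monoˡ-<; module ≤-Reasoning; +-commutativeSemigroup)
open import Algebra.Properties.CommutativeSemigroup +-commutativeSemigroup using (interchange)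
open import Data.Fin using (Fin; zero; suc; _↑ˡ_; _↑ʳ_; splitAt; combine; remQuot)
open import Data.Fin.Properties
  using (_≟_; suc-injective; splitAt-↑ˡ; splitAt-↑ʳ; splitAt⁻¹-↑ˡ; splitAt⁻¹-↑ʳ;
         remQuot-combine; combine-remQuot)
open import Data.Fin.Subset using (Subset; _∈_; ∣_∣; inside; outside)
import Data.Fin.Subset as Subset
open import Data.Fin.Subset.Properties using (∈⊤; ∣⊤∣≡n; ∣⊥∣≡0)
open import Data.Bool using (Bool; true; false; not; if_then_else_)
open import Data.Vec using ([]; _∷_; _++_; tabulate; sum; lookup; there)
open import Data.Vec.Properties using ([]=⇒lookup; lookup⇒[]=; lookup-++ˡ; lookup-replicate)
open import Data.Product using (Σ; _×_; _,_; proj₁; proj₂; uncurry)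
open import Data.Sum using (_⊎_; inj₁; inj₂; [_,_]′)
open import Data.Empty using (⊥; ⊥-elim)
open import Relation.Nullary using (Dec; yes; no; does)
open import Relation.Nullary.Decidable using (dec-true; dec-false)
open import Relation.Binary using (tri<; tri≈; tri>)
open import Relation.Binary.PropositionalEquality
open import Function using (_∘_)

fromBool : Bool → ℕ
fromBool true  = 1
fromBool false = 0

indicator : ∀ {m} → Subset m → Fin m → ℕ
indicator S x = fromBool (lookup S x)

indicator-positive : ∀ {m} (S : Subset m) {x} → x ∈ S → 0 < indicator S x
indicator-positive S x∈S rewrite []=⇒lookup x∈S = s≤s z≤n

sum-indicator : ∀ {m} (S : Subset m) → sum (tabulate (indicator S)) ≡ ∣ S ∣
sum-indicator []          = refl
sum-indicator (true ∷ S)  = cong suc (sum-indicator S)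
sum-indicator (false ∷ S) = sum-indicator S

∣⊤++⊥∣ : ∀ m {n} → ∣ Subset.⊤ {m} ++ Subset.⊥ {n} ∣ ≡ m
∣⊤++⊥∣ zero    {n} = ∣⊥∣≡0 n
∣⊤++⊥∣ (suc m)     = cong suc (∣⊤++⊥∣ m)

sum-split : ∀ m {n} (f : Fin (m + n) → ℕ) →
  sum (tabulate f) ≡ sum (tabulate (λ i → f (i ↑ˡ n))) + sum (tabulate (λ j → f (m ↑ʳ j)))
sum-split zero    f = refl
sum-split (suc m) f =
  trans (cong (f zero +_) (sum-split m (λ i → f (suc i)))) (sym (+-assoc (f zero) _ _))

sum-positive : ∀ m (f : Fin m → ℕ) → (∀ i → 0 < f i) → m ≤ sum (tabulate f)
sum-positive zero    f pos = z≤n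
sum-positive (suc m) f pos = +-mono-≤ (pos zero) (sum-positive m (λ i → f (suc i)) (λ i → pos (suc i)))

sum-pairs : ∀ m (f h : Fin m → ℕ) → (∀ i → 0 < f i ⊎ 0 < h i) →
  m ≤ sum (tabulate f) + sum (tabulate h)
sum-pairs zero    f h cover = z≤n
sum-pairs (suc m) f h cover = begin
  1 + m                         ≤⟨ +-mono-≤ (one-positive (cover zero)) (sum-pairs m f′ h′ (λ i → cover (suc i))) ⟩
  (f zero + h zero) + (F + H)   ≡⟨ interchange (f zero) (h zero) F H ⟩
  (f zero + F) + (h zero + H)   ∎
  where
  open ≤-Reasoning
  f′ h′ : Fin m → ℕ
  f′ i = f (suc i)
  h′ i = h (suc i)
  F H : ℕ
  F = sum (tabulate f′)
  H = sum (tabulate h′)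
  one-positive : 0 < f zero ⊎ 0 < h zero → 1 ≤ f zero + h zero
  one-positive (inj₁ p) = ≤-trans p (m≤m+n (f zero) (h zero))
  one-positive (inj₂ p) = ≤-trans p (m≤n+m (h zero) (f zero))

-- If of any two distinct terms one is positive, then all but at most one of
-- the m + 1 terms are positive, so they sum to at least m.
sum-all-but-one : ∀ m (f : Fin (suc m) → ℕ) → (∀ i j → i ≢ j → 0 < f i ⊎ 0 < f j) →
  m ≤ sum (tabulate f)
sum-all-but-one zero    f cover = z≤n
sum-all-but-one (suc m) f cover with f zero in f₀
... | suc a = +-mono-≤ (s≤s (z≤n {a}))
                (sum-all-but-one m (λ i → f (suc i)) (λ i j i≢j → cover (suc i) (suc j) (i≢j ∘ suc-injective)))
... | zero  = sum-positive (suc m) (λ i → f (suc i)) rest-positive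
  where
  rest-positive : ∀ i → 0 < f (suc i)
  rest-positive i with cover zero (suc i) (λ ())
  ... | inj₁ p with () ← subst (0 <_) f₀ p
  ... | inj₂ p = p

module _ (G : Graph) where

  dist-unique : ∀ {x z a b} → Dist G x z a → Dist G x z b → a ≡ b
  dist-unique {a = a} {b} (wa , shortest-a) (wb , shortest-b) with <-cmp a b
  ... | tri< a<b _ _ = ⊥-elim (shortest-b a a<b wa)
  ... | tri≈ _ a≡b _ = a≡b
  ... | tri> _ _ b<a = ⊥-elim (shortest-a b b<a wb)

  walk-0 : ∀ {x z} → Walk G x z 0 → x ≡ z
  walk-0 (nil _) = refl

  walk-1 : ∀ {x z} → Walk G x z 1 → adj G x z ≡ true
  walk-1 (cons e (nil _)) = e

  truncated⇒distinguishes : ∀ {i z x y} → DistinguishesT G i z x y → Distinguishes G z x y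
  truncated⇒distinguishes D a b da db a≡b = D a b da db (cong (trunc _) a≡b)

  adjResolving⇒resolving : ∀ S → IsAdjResolving G S → IsResolving G S
  adjResolving⇒resolving S R x y x≢y with R x y x≢y
  ... | z , z∈S , D = z , z∈S , truncated⇒distinguishes D

  Twins : V G → V G → Set
  Twins x y = ∀ z → z ≢ x → z ≢ y → adj G x z ≡ adj G y z

  TwinPairs : (V G → V G → Set) → Set
  TwinPairs R = ∀ {x y} → R x y → x ≢ y × Twins x y

  CoversPairs : (V G → V G → Set) → (V G → ℕ) → Set
  CoversPairs R g = ∀ {x y} → R x y → 0 < g x ⊎ 0 < g y

-- Graphs with a universal vertex u

-- The distance between distinct vertices is 1 along an edge and 2 via u.
adjDist : Bool → ℕ
adjDist true  = 1
adjDist false = 2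

adjDist≤2 : ∀ b → adjDist b ≤ 2
adjDist≤2 true  = s≤s z≤n
adjDist≤2 false = s≤s (s≤s z≤n)

adjDist≢0 : ∀ b → adjDist b ≢ 0
adjDist≢0 true  ()
adjDist≢0 false ()

module Universal (G : Graph) (u : V G) (universal : ∀ v → v ≢ u → adj G u v ≡ true) where

  δ : V G → V G → ℕ
  δ x z with x ≟ z
  ... | yes _ = 0
  ... | no  _ = adjDist (adj G x z)

  δ-self : ∀ x → δ x x ≡ 0
  δ-self x with x ≟ x
  ... | yes _   = refl
  ... | no  x≢x = ⊥-elim (x≢x refl)

  δ-≢ : ∀ {x z} → x ≢ z → δ x z ≡ adjDist (adj G x z)
  δ-≢ {x} {z} x≢z with x ≟ z
  ... | yes x≡z = ⊥-elim (x≢z x≡z)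
  ... | no  _   = refl

  δ-zero : ∀ {x z} → δ x z ≡ 0 → x ≡ z
  δ-zero {x} {z} δ≡0 with x ≟ z
  ... | yes x≡z = x≡z
  ... | no  _   = ⊥-elim (adjDist≢0 (adj G x z) δ≡0)

  δ≤2 : ∀ x z → δ x z ≤ 2
  δ≤2 x z with x ≟ z
  ... | yes _ = z≤n
  ... | no  _ = adjDist≤2 (adj G x z)

  dist-δ : ∀ x z → Dist G x z (δ x z)
  dist-δ x z with x ≟ z
  ... | yes refl = nil x , λ { _ () _ }
  ... | no  x≢z with adj G x z in x~z
  ...   | true  = cons x~z (nil z) , λ { zero _ w → x≢z (walk-0 G w) ; (suc _) (s≤s ()) _ }
  ...   | false = cons x~u (cons u~z (nil z)) , shortest
    where
    x≁z : adj G x z ≢ true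
    x≁z e with () ← trans (sym x~z) e
    z≢u : z ≢ u
    z≢u refl = x≁z (trans (Graph.sym G x u) (universal x x≢z))
    x≢u : x ≢ u
    x≢u refl = x≁z (universal z (λ z≡u → x≢z (sym z≡u)))
    x~u : adj G x u ≡ true
    x~u = trans (Graph.sym G x u) (universal x x≢u)
    u~z : adj G u z ≡ true
    u~z = universal z z≢u
    shortest : ∀ m → m < 2 → Walk G x z m → ⊥
    shortest zero          _ w = x≢z (walk-0 G w)
    shortest (suc zero)    _ w = x≁z (walk-1 G w)
    shortest (suc (suc _)) (s≤s (s≤s ())) _

  connected : Connected G
  connected x y = δ x y , proj₁ (dist-δ x y)

  δ-distinguishes : ∀ {x y z} → δ x z ≢ δ y z → DistinguishesT G 1 z x y
  δ-distinguishes {x} {y} {z} δ≢ a b da db trunc≡ = δ≢ (begin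
    δ x z           ≡⟨ m≤n⇒m⊓n≡m (δ≤2 x z) ⟨
    trunc 1 (δ x z) ≡⟨ cong (trunc 1) (dist-unique G da (dist-δ x z)) ⟨
    trunc 1 a       ≡⟨ trunc≡ ⟩
    trunc 1 b       ≡⟨ cong (trunc 1) (dist-unique G db (dist-δ y z)) ⟩
    trunc 1 (δ y z) ≡⟨ m≤n⇒m⊓n≡m (δ≤2 y z) ⟩
    δ y z           ∎)
    where open ≡-Reasoning

  distinguishes-δ : ∀ {x y z} → Distinguishes G z x y → δ x z ≢ δ y z
  distinguishes-δ {x} {y} {z} D = D (δ x z) (δ y z) (dist-δ x z) (dist-δ y z)

  twin-distinguisher : ∀ {x y z} → Twins G x y → Distinguishes G z x y → z ≡ x ⊎ z ≡ y
  twin-distinguisher {x} {y} {z} twins D with z ≟ x | z ≟ y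
  ... | yes z≡x | _       = inj₁ z≡x
  ... | no  _   | yes z≡y = inj₂ z≡y
  ... | no  z≢x | no  z≢y = ⊥-elim (distinguishes-δ D (begin
    δ x z                ≡⟨ δ-≢ (z≢x ∘ sym) ⟩
    adjDist (adj G x z)  ≡⟨ cong adjDist (twins z z≢x z≢y) ⟩
    adjDist (adj G y z)  ≡⟨ δ-≢ (z≢y ∘ sym) ⟨
    δ y z                ∎))
    where open ≡-Reasoning

  Separates : Subset (n G) → Set
  Separates S = ∀ x y → x ≢ y → Σ (V G) λ z → z ∈ S × δ x z ≢ δ y z

  separating⇒adjResolving : ∀ S → Separates S → IsAdjResolving G S
  separating⇒adjResolving S sep x y x≢y with sep x y x≢y
  ... | z , z∈S , δ≢ = z , z∈S , δ-distinguishes δ≢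

  adjResolving⇒broadcast : ∀ S → IsAdjResolving G S → IsResolvingBroadcast G (indicator S)
  adjResolving⇒broadcast S R x y x≢y with R x y x≢y
  ... | z , z∈S , D = z , 0 , cong fromBool ([]=⇒lookup z∈S) , D

  resolving-covers : ∀ {R} → TwinPairs G R → ∀ S → IsResolving G S → CoversPairs G R (indicator S)
  resolving-covers twins S res Rxy with twins Rxy
  ... | x≢y , tw with res _ _ x≢y
  ...   | z , z∈S , D with twin-distinguisher tw D
  ...     | inj₁ refl = inj₁ (indicator-positive S z∈S)
  ...     | inj₂ refl = inj₂ (indicator-positive S z∈S)

  broadcast-covers : ∀ {R} → TwinPairs G R → ∀ f → IsResolvingBroadcast G f → CoversPairs G R f
  broadcast-covers twins f res Rxy with twins Rxy
  ... | x≢y , tw with res _ _ x≢y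
  ...   | z , i , fz≡ , D with twin-distinguisher tw (truncated⇒distinguishes G D)
  ...     | inj₁ refl = inj₁ (subst (0 <_) (sym fz≡) (s≤s z≤n))
  ...     | inj₂ refl = inj₂ (subst (0 <_) (sym fz≡) (s≤s z≤n))

  dimensions : ∀ {m} (S : Subset (n G)) → Separates S → ∣ S ∣ ≡ m →
    ∀ R → TwinPairs G R → (∀ g → CoversPairs G R g → m ≤ cost G g) →
    IsDim G m × IsBdim G m × IsAdim G m
  dimensions {m} S sep ∣S∣≡m R twins lower =
    (  (S , adjResolving⇒resolving G S adjRes , ∣S∣≡m)
     , λ S′ res → set-lower S′ (resolving-covers twins S′ res))
    , (  (indicator S , adjResolving⇒broadcast S adjRes , trans (sum-indicator S) ∣S∣≡m)
       , λ f res → lower f (broadcast-covers twins f res))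
    , (  (S , adjRes , ∣S∣≡m)
       , λ S′ res → set-lower S′ (resolving-covers twins S′ (adjResolving⇒resolving G S′ res)))
    where
    adjRes : IsAdjResolving G S
    adjRes = separating⇒adjResolving S sep
    set-lower : ∀ S′ → CoversPairs G R (indicator S′) → m ≤ ∣ S′ ∣
    set-lower S′ cover = subst (m ≤_) (sum-indicator S′) (lower (indicator S′) cover)

-- Stars: the centre zero joined to the leaves  suc i  (i : Fin m)

star-adj : ∀ {m} → Fin (suc m) → Fin (suc m) → Bool
star-adj zero    zero    = false
star-adj zero    (suc _) = true
star-adj (suc _) zero    = true
star-adj (suc _) (suc _) = false

star : ℕ → Graph
star m = record
  { n   = suc m
  ; adj = star-adj
  ; sym = λ { zero zero → refl ; zero (suc _) → refl ; (suc _) zero → refl ; (suc _) (suc _) → refl }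
  ; irr = λ { zero → refl ; (suc _) → refl }
  }

star-universal : ∀ {m} (v : V (star m)) → v ≢ zero → star-adj zero v ≡ true
star-universal zero    v≢0 = ⊥-elim (v≢0 refl)
star-universal (suc _) _   = refl

DistinctLeaves : ∀ {m} → V (star m) → V (star m) → Set
DistinctLeaves (suc i) (suc j) = i ≢ j
DistinctLeaves _       _       = ⊥

leaves-twins : ∀ m → TwinPairs (star m) DistinctLeaves
leaves-twins m {suc i} {suc j} i≢j = i≢j ∘ suc-injective , twins
  where
  twins : Twins (star m) (suc i) (suc j)
  twins zero    _ _ = refl
  twins (suc _) _ _ = refl

-- A star with L + 2 leaves has dim = bdim = adim = L + 1: all leaves but
-- one form a separating set, and all leaves but one must be used.
star-dimensions : ∀ L →
  IsDim (star (suc (suc L))) (suc L) × IsBdim (star (suc (suc L))) (suc L) × IsAdim (star (suc (suc L))) (suc L)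
star-dimensions L =
  dimensions S separates (∣⊤∣≡n (suc L)) DistinctLeaves (leaves-twins _) lower
  where
  open Universal (star (suc (suc L))) zero star-universal
  -- S: all leaves except  suc zero
  S : Subset (suc (suc (suc L)))
  S = outside ∷ outside ∷ Subset.⊤
  -- a leaf of S is distinguished from every other vertex by itself
  self-separates : ∀ l y → suc (suc l) ≢ y → δ (suc (suc l)) (suc (suc l)) ≢ δ y (suc (suc l))
  self-separates l y ne δ≡ = ne (sym (δ-zero (trans (sym δ≡) (δ-self (suc (suc l))))))
  separates : Separates S
  separates (suc (suc l)) y       ne = suc (suc l) , there (there ∈⊤) , self-separates l y ne
  separates x (suc (suc l))       ne = suc (suc l) , there (there ∈⊤) , self-separates l x (ne ∘ sym) ∘ sym
  -- the centre (distance 1) and the leaf outside S (distance 2) are told apart by a leaf of S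
  separates zero    zero          ne = ⊥-elim (ne refl)
  separates (suc zero) (suc zero) ne = ⊥-elim (ne refl)
  separates zero    (suc zero)    ne = suc (suc zero) , there (there ∈⊤) , λ ()
  separates (suc zero) zero       ne = suc (suc zero) , there (there ∈⊤) , λ ()
  -- the leaves carry weight on all but at most one of them
  lower : ∀ g → CoversPairs (star (suc (suc L))) DistinctLeaves g → suc L ≤ cost (star (suc (suc L))) g
  lower g cover = ≤-trans (sum-all-but-one (suc L) (g ∘ suc) (λ i j i≢j → cover {suc i} {suc j} i≢j))
                          (m≤n+m _ (g zero))

module Construction (k : ℕ) where

  t : ℕ
  t = k + k

  data Vertex : Set where
    centre : Vertex
    twin   : Bool → Fin t → Vertex
    extra  : Fin k → Fin k → Vertex

  IsCoord : Fin t → Fin k → Fin k → Bool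
  IsCoord l a b = [ (λ a′ → does (a′ ≟ a)) , (λ b′ → does (b′ ≟ b)) ]′ (splitAt k l)

  adjV : Vertex → Vertex → Bool
  adjV centre      centre      = false
  adjV centre      _           = true
  adjV (twin _ i)  centre      = true
  adjV (twin _ i)  (twin _ j)  = not (does (i ≟ j))
  adjV (twin _ i)  (extra a b) = not (IsCoord i a b)
  adjV (extra _ _) centre      = true
  adjV (extra a b) (twin _ l)  = not (IsCoord l a b)
  adjV (extra _ _) (extra _ _) = false

  ≟-sym : ∀ {m} (i j : Fin m) → does (i ≟ j) ≡ does (j ≟ i)
  ≟-sym i j with i ≟ j | j ≟ i
  ... | yes _   | yes _   = refl
  ... | no  _   | no  _   = refl
  ... | yes i≡j | no  j≢i = ⊥-elim (j≢i (sym i≡j))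
  ... | no  i≢j | yes j≡i = ⊥-elim (i≢j (sym j≡i))

  adjV-sym : ∀ v w → adjV v w ≡ adjV w v
  adjV-sym centre      centre      = refl
  adjV-sym centre      (twin _ _)  = refl
  adjV-sym centre      (extra _ _) = refl
  adjV-sym (twin _ _)  centre      = refl
  adjV-sym (twin _ i)  (twin _ j)  = cong not (≟-sym i j)
  adjV-sym (twin _ _)  (extra _ _) = refl
  adjV-sym (extra _ _) centre      = refl
  adjV-sym (extra _ _) (twin _ _)  = refl
  adjV-sym (extra _ _) (extra _ _) = refl

  adjV-irr : ∀ v → adjV v v ≡ false
  adjV-irr centre      = refl
  adjV-irr (twin _ i)  = cong not (dec-true (i ≟ i) refl)
  adjV-irr (extra _ _) = refl

  adjV-side : ∀ s s′ l w → adjV (twin s l) w ≡ adjV (twin s′ l) w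
  adjV-side s s′ l centre      = refl
  adjV-side s s′ l (twin _ _)  = refl
  adjV-side s s′ l (extra _ _) = refl

  adjV-centre : ∀ w → w ≢ centre → adjV centre w ≡ true
  adjV-centre centre      w≢c = ⊥-elim (w≢c refl)
  adjV-centre (twin _ _)  _   = refl
  adjV-centre (extra _ _) _   = refl

  N : ℕ
  N = suc (t + (t + k * k))

  encode : Vertex → Fin N
  encode centre         = zero
  encode (twin true l)  = suc (l ↑ˡ (t + k * k))
  encode (twin false l) = suc (t ↑ʳ (l ↑ˡ (k * k)))
  encode (extra a b)    = suc (t ↑ʳ (t ↑ʳ combine a b))

  decode : Fin N → Vertex
  decode zero    = centre
  decode (suc x) = [ twin true , [ twin false , uncurry extra ∘ remQuot k ]′ ∘ splitAt t ]′ (splitAt t x)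

  decode-encode : ∀ v → decode (encode v) ≡ v
  decode-encode centre = refl
  decode-encode (twin true l) rewrite splitAt-↑ˡ t l (t + k * k) = refl
  decode-encode (twin false l)
    rewrite splitAt-↑ʳ t (t + k * k) (l ↑ˡ (k * k)) | splitAt-↑ˡ t l (k * k) = refl
  decode-encode (extra a b)
    rewrite splitAt-↑ʳ t (t + k * k) (t ↑ʳ combine a b) | splitAt-↑ʳ t (k * k) (combine a b)
    = cong (uncurry extra) (remQuot-combine a b)

  encode-decode : ∀ x → encode (decode x) ≡ x
  encode-decode zero = refl
  encode-decode (suc x) with splitAt t x in x≡
  ... | inj₁ l = cong suc (splitAt⁻¹-↑ˡ x≡)
  ... | inj₂ y with splitAt t y in y≡
  ...   | inj₁ l = cong suc (trans (cong (t ↑ʳ_) (splitAt⁻¹-↑ˡ y≡)) (splitAt⁻¹-↑ʳ x≡))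
  ...   | inj₂ z = cong suc (trans (cong (λ w → t ↑ʳ (t ↑ʳ w)) (combine-remQuot {k} k z))
                                   (trans (cong (t ↑ʳ_) (splitAt⁻¹-↑ʳ y≡)) (splitAt⁻¹-↑ʳ x≡)))

  decode⇒encode : ∀ {x v} → decode x ≡ v → x ≡ encode v
  decode⇒encode {x} d≡ = trans (sym (encode-decode x)) (cong encode d≡)

  decode-injective : ∀ {x y} → x ≢ y → decode x ≢ decode y
  decode-injective {x} {y} x≢y d≡ = x≢y (trans (decode⇒encode d≡) (encode-decode y))

  encode-injective : ∀ {v w} → v ≢ w → encode v ≢ encode w
  encode-injective {v} {w} v≢w e≡ = v≢w (trans (sym (decode-encode v)) (trans (cong decode e≡) (decode-encode w)))

  G : Graph
  G = record
    { n   = N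
    ; adj = λ x y → adjV (decode x) (decode y)
    ; sym = λ x y → adjV-sym (decode x) (decode y)
    ; irr = λ x → adjV-irr (decode x)
    }

  centre-universal : ∀ x → x ≢ zero → adj G zero x ≡ true
  centre-universal x x≢0 = adjV-centre (decode x) (x≢0 ∘ decode⇒encode)

  open Universal G zero centre-universal

  -- profile v l: the distance from v to the twin  twin true l.  These
  -- patterns are pairwise different, so the side-true twins resolve G.
  profile : Vertex → Fin t → ℕ
  profile centre         l = 1
  profile (twin true i)  l = if does (i ≟ l) then 0 else 1
  profile (twin false i) l = if does (i ≟ l) then 2 else 1
  profile (extra a b)    l = if IsCoord l a b then 2 else 1

  adjDist-not : ∀ b → adjDist (not b) ≡ (if b then 2 else 1)
  adjDist-not true  = refl
  adjDist-not false = refl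

  profile-self : ∀ l → profile (twin true l) l ≡ 0
  profile-self l = cong (λ b → if b then 0 else 1) (dec-true (l ≟ l) refl)

  profile-off : ∀ v l → v ≢ twin true l → profile v l ≡ adjDist (adjV v (twin true l))
  profile-off centre         l _   = refl
  profile-off (twin true i)  l v≢ rewrite dec-false (i ≟ l) (v≢ ∘ cong (twin true)) = refl
  profile-off (twin false i) l _   = sym (adjDist-not (does (i ≟ l)))
  profile-off (extra a b)    l _   = sym (adjDist-not (IsCoord l a b))

  δ-profile : ∀ x l → δ x (encode (twin true l)) ≡ profile (decode x) l
  δ-profile x l = by-cases (x ≟ e)
    where
    open ≡-Reasoning
    e : Fin N
    e = encode (twin true l)
    by-cases : Dec (x ≡ e) → δ x e ≡ profile (decode x) l
    by-cases (yes x≡e) = begin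
      δ x e                   ≡⟨ cong (λ y → δ y e) x≡e ⟩
      δ e e                   ≡⟨ δ-self e ⟩
      0                       ≡⟨ profile-self l ⟨
      profile (twin true l) l ≡⟨ cong (λ v → profile v l) (trans (cong decode x≡e) (decode-encode (twin true l))) ⟨
      profile (decode x) l    ∎
    by-cases (no x≢e) = begin
      δ x e                                   ≡⟨ δ-≢ x≢e ⟩
      adjDist (adjV (decode x) (decode e))    ≡⟨ cong (λ w → adjDist (adjV (decode x) w)) (decode-encode (twin true l)) ⟩
      adjDist (adjV (decode x) (twin true l)) ≡⟨ profile-off (decode x) l (x≢e ∘ decode⇒encode) ⟨
      profile (decode x) l                    ∎

  profile-zero : ∀ v l → profile v l ≡ 0 → v ≡ twin true l
  profile-zero centre         l ()
  profile-zero (twin true i)  l p with i ≟ l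
  ... | yes i≡l = cong (twin true) i≡l
  profile-zero (twin true i)  l () | no _
  profile-zero (twin false i) l p with does (i ≟ l)
  profile-zero (twin false i) l () | true
  profile-zero (twin false i) l () | false
  profile-zero (extra a b)    l p with IsCoord l a b
  profile-zero (extra a b)    l () | true
  profile-zero (extra a b)    l () | false

  twin-false-self : ∀ i → profile (twin false i) i ≡ 2
  twin-false-self i = cong (λ b → if b then 2 else 1) (dec-true (i ≟ i) refl)

  twin-false-other : ∀ {i l} → i ≢ l → profile (twin false i) l ≡ 1
  twin-false-other {i} {l} i≢l = cong (λ b → if b then 2 else 1) (dec-false (i ≟ l) i≢l)

  extra-left : ∀ a a′ b′ → profile (extra a′ b′) (a ↑ˡ k) ≡ (if does (a ≟ a′) then 2 else 1)
  extra-left a a′ b′ rewrite splitAt-↑ˡ k a k = refl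

  extra-right : ∀ b a′ b′ → profile (extra a′ b′) (k ↑ʳ b) ≡ (if does (b ≟ b′) then 2 else 1)
  extra-right b a′ b′ rewrite splitAt-↑ʳ k k b = refl

  extra-hit-left : ∀ a b → profile (extra a b) (a ↑ˡ k) ≡ 2
  extra-hit-left a b = trans (extra-left a a b) (cong (λ c → if c then 2 else 1) (dec-true (a ≟ a) refl))

  extra-hit-right : ∀ a b → profile (extra a b) (k ↑ʳ b) ≡ 2
  extra-hit-right a b = trans (extra-right b a b) (cong (λ c → if c then 2 else 1) (dec-true (b ≟ b) refl))

  extra-miss-left : ∀ {a a′} b′ → a ≢ a′ → profile (extra a′ b′) (a ↑ˡ k) ≡ 1
  extra-miss-left {a} {a′} b′ a≢ = trans (extra-left a a′ b′) (cong (λ c → if c then 2 else 1) (dec-false (a ≟ a′) a≢))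

  extra-miss-right : ∀ {b b′} a′ → b ≢ b′ → profile (extra a′ b′) (k ↑ʳ b) ≡ 1
  extra-miss-right {b} {b′} a′ b≢ = trans (extra-right b a′ b′) (cong (λ c → if c then 2 else 1) (dec-false (b ≟ b′) b≢))

  coords-distinct : ∀ (a b : Fin k) → a ↑ˡ k ≢ k ↑ʳ b
  coords-distinct a b eq with trans (sym (splitAt-↑ˡ k a k)) (trans (cong (splitAt k) eq) (splitAt-↑ʳ k k b))
  ... | ()

  Separated : Vertex → Vertex → Set
  Separated v w = Σ (Fin t) λ l → profile v l ≢ profile w l

  two≢one : ∀ {p q} → p ≡ 2 → q ≡ 1 → p ≢ q
  two≢one refl refl ()

  flip-separated : ∀ v w → Separated v w → Separated w v
  flip-separated _ _ (l , ne) = l , ne ∘ sym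

  -- A side-false twin has a single 2 in its profile, an extra vertex has two.
  twin-false-vs-extra : ∀ i a b → Separated (twin false i) (extra a b)
  twin-false-vs-extra i a b with i ≟ a ↑ˡ k
  ... | yes refl = k ↑ʳ b , two≢one (extra-hit-right a b) (twin-false-other (coords-distinct a b)) ∘ sym
  ... | no  i≢   = a ↑ˡ k , two≢one (extra-hit-left a b) (twin-false-other i≢) ∘ sym

  separate : ∀ v w → v ≢ w → Separated v w
  separate (twin true i) w ne = i , λ e → ne (sym (profile-zero w i (trans (sym e) (profile-self i))))
  separate v (twin true j) ne = flip-separated (twin true j) v (separate (twin true j) v (ne ∘ sym))
  separate centre centre ne = ⊥-elim (ne refl)
  separate centre (twin false j) ne = flip-separated (twin false j) centre (j , two≢one (twin-false-self j) refl)
  separate centre (extra a b) ne = flip-separated (extra a b) centre (a ↑ˡ k , two≢one (extra-hit-left a b) refl)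
  separate (twin false i) centre ne = i , two≢one (twin-false-self i) refl
  separate (twin false i) (twin false j) ne =
    i , two≢one (twin-false-self i) (twin-false-other (ne ∘ cong (twin false) ∘ sym))
  separate (twin false i) (extra a b) ne = twin-false-vs-extra i a b
  separate (extra a b) centre ne = a ↑ˡ k , two≢one (extra-hit-left a b) refl
  separate (extra a b) (twin false j) ne = flip-separated (twin false j) (extra a b) (twin-false-vs-extra j a b)
  separate (extra a b) (extra a′ b′) ne with a ≟ a′
  ... | no  a≢   = a ↑ˡ k , two≢one (extra-hit-left a b) (extra-miss-left b′ a≢)
  ... | yes refl = k ↑ʳ b , two≢one (extra-hit-right a b) (extra-miss-right a (ne ∘ cong (extra a)))

  -- The twins of side true form the separating set.
  resolvers : Subset N
  resolvers = outside ∷ (Subset.⊤ {t} ++ Subset.⊥ {t + k * k})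

  resolver-∈ : ∀ l → encode (twin true l) ∈ resolvers
  resolver-∈ l = there (lookup⇒[]= (l ↑ˡ (t + k * k)) (Subset.⊤ {t} ++ Subset.⊥ {t + k * k})
                   (trans (lookup-++ˡ Subset.⊤ (Subset.⊥ {t + k * k}) l) (lookup-replicate l inside)))

  resolvers-separate : Separates resolvers
  resolvers-separate x y x≢y with separate (decode x) (decode y) (decode-injective x≢y)
  ... | l , ne = encode (twin true l) , resolver-∈ l ,
                 λ δ≡ → ne (trans (sym (δ-profile x l)) (trans δ≡ (δ-profile y l)))

  TwinPair : V G → V G → Set
  TwinPair x y = Σ (Fin t) λ l → x ≡ encode (twin true l) × y ≡ encode (twin false l)

  twin-pairs : TwinPairs G TwinPair
  twin-pairs (l , refl , refl) = encode-injective {twin true l} {twin false l} (λ ()) , twins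
    where
    twins : Twins G (encode (twin true l)) (encode (twin false l))
    twins z _ _ rewrite decode-encode (twin true l) | decode-encode (twin false l) =
      adjV-side true false l (decode z)

  twin-pairs-weight : ∀ g → CoversPairs G TwinPair g → t ≤ cost G g
  twin-pairs-weight g cover = begin
    t                                         ≤⟨ sum-pairs t first second (λ l → cover (l , refl , refl)) ⟩
    sum (tabulate first) + sum (tabulate second) ≤⟨ +-monoʳ-≤ (sum (tabulate first)) (m≤m+n _ _) ⟩
    sum (tabulate first) + (sum (tabulate second) + sum (tabulate extras))
                                              ≡⟨ cong (sum (tabulate first) +_) (sum-split t (λ j → g (suc (t ↑ʳ j)))) ⟨
    sum (tabulate first) + sum (tabulate (λ j → g (suc (t ↑ʳ j))))
                                              ≡⟨ sum-split t (g ∘ suc) ⟨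
    sum (tabulate (g ∘ suc))                  ≤⟨ m≤n+m _ (g zero) ⟩
    cost G g                                  ∎
    where
    open ≤-Reasoning
    first second : Fin t → ℕ
    first  l = g (encode (twin true l))
    second l = g (encode (twin false l))
    extras : Fin (k * k) → ℕ
    extras j = g (suc (t ↑ʳ (t ↑ʳ j)))

  G-dimensions : IsDim G t × IsBdim G t × IsAdim G t
  G-dimensions = dimensions resolvers resolvers-separate (∣⊤++⊥∣ t) TwinPair twin-pairs twin-pairs-weight

  G-connected : Connected G
  G-connected = connected

  spanning-star : Subgraph (star (t + (t + k * k))) G
  spanning-star = (λ x → x) , (λ x≡y → x≡y) , edges
    where
    edges : ∀ x y → star-adj x y ≡ true → adj G x y ≡ true
    edges zero    (suc y) _ = centre-universal (suc y) (λ ())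
    edges (suc x) zero    _ = trans (Graph.sym G (suc x) zero) (centre-universal (suc x) (λ ()))
    edges zero    zero    ()
    edges (suc _) (suc _) ()

doubled-bound : ∀ M k → M + M < k → M * (k + k) < k * k
doubled-bound M k M+M<k = begin-strict
  M * (k + k)    ≡⟨ *-distribˡ-+ M k k ⟩
  M * k + M * k  ≡⟨ *-distribʳ-+ k M M ⟨
  (M + M) * k    <⟨ *-monoˡ-< k {{nonZero}} M+M<k ⟩
  k * k          ∎
  where
  open ≤-Reasoning
  nonZero : NonZero k
  nonZero = >-nonZero (≤-trans (s≤s z≤n) M+M<k)

-- G = G(k) with k = 2M + 2 and H its spanning star: the three parameters
-- are t = 2k for G and L + 1 ≥ k² for H.
theorem5p7 : (M : ℕ) → Σ Graph λ G → Σ Graph λ H →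
    Connected G × Connected H × Subgraph H G ×
    (Σ ℕ λ dG → Σ ℕ λ dH → IsDim G dG × IsDim H dH × 0 < dG × M * dG < dH) ×
    (Σ ℕ λ bG → Σ ℕ λ bH → IsBdim G bG × IsBdim H bH × 0 < bG × M * bG < bH) ×
    (Σ ℕ λ aG → Σ ℕ λ aH → IsAdim G aG × IsAdim H aH × 0 < aG × M * aG < aH)
theorem5p7 M =
  G , H , G-connected , Universal.connected H zero star-universal , spanning-star ,
  compare IsDim  (proj₁ G-dimensions)         (proj₁ (star-dimensions L)) ,
  compare IsBdim (proj₁ (proj₂ G-dimensions)) (proj₁ (proj₂ (star-dimensions L))) ,
  compare IsAdim (proj₂ (proj₂ G-dimensions)) (proj₂ (proj₂ (star-dimensions L)))
  where
  k : ℕ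
  k = suc (suc (M + M))
  open Construction k
  -- H has t + (t + k * k) = L + 2 leaves
  L : ℕ
  L = (M + M + k) + (t + k * k)
  H : Graph
  H = star (suc (suc L))
  ratio : M * t < suc L
  ratio = <-≤-trans (doubled-bound M k (s≤s (n≤1+n (M + M))))
                    (≤-trans (m≤n+m (k * k) t) (≤-trans (m≤n+m (t + k * k) (M + M + k)) (n≤1+n L)))
  compare : (P : Graph → ℕ → Set) → P G t → P H (suc L) →
    Σ ℕ λ pG → Σ ℕ λ pH → P G pG × P H pH × 0 < pG × M * pG < pH
  compare P PG PH = t , suc L , PG , PH , s≤s z≤n , ratio
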